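{- Let $n\ge 2$ and $k\ge 1$ be integers. If $n$ is exactly $k$-deficient-perfect and $n$ has exactly one distinct prime factor, then $k=1$ and $n$ is a power of $2$. Consequently, if $n$ is exactly $k$-deficient-perfect with $k\ge 2$, then $n$ has at least two distinct prime divisors; in particular every exactly $3$-deficient-perfect number has at least two distinct prime divisors.
   Context: For a positive integer $n$, $\sigma(n)$ denotes the sum of all positive divisors of $n$. For a positive integer $k$, $n$ is called exactly $k$-deficient-perfect if there exist distinct proper divisors $d_1,\dots,d_k$ of $n$ (positive divisors less than $n$) with $\sigma(n) = 2n-(d_1+d_2+\cdots+d_k)$. -}

module Defs where

open import Data.Nat using (ℕ; suc; _+_; _*_; _^_; _<_; _≤_)
open import Data.Nat.Divisibility using (_∣_; _∣?_)
open import Data.Nat.Primality using (Prime)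
open import Data.List using (List; filter; map; upTo; length)
open import Data.Nat.ListAction using (sum)
open import Data.List.Relation.Unary.All using (All)
open import Data.List.Relation.Unary.Unique.Propositional using (Unique)
open import Data.Product using (Σ; ∃; ∃-syntax; _×_)
open import Relation.Binary.PropositionalEquality using (_≡_; _≢_)

divisors : ℕ → List ℕ
divisors n = filter (_∣? n) (map suc (upTo n))

σ : ℕ → ℕ
σ n = sum (divisors n)

ProperDivisor : ℕ → ℕ → Set
ProperDivisor n d = (0 < d) × (d ∣ n) × (d < n)

-- n is exactly k-deficient-perfect: there are k distinct proper divisors
-- d₁,…,dₖ of n with σ(n) = 2n − (d₁ + ⋯ + dₖ)  (stated additively)
ExactlyDeficientPerfect : ℕ → ℕ → Set
ExactlyDeficientPerfect k n =
  ∃[ ds ] (length ds ≡ k) × Unique ds × All (ProperDivisor n) ds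
          × (σ n + sum ds ≡ 2 * n)

HasExactlyOnePrimeFactor : ℕ → Set
HasExactlyOnePrimeFactor n =
  ∃[ p ] Prime p × p ∣ n × (∀ q → Prime q → q ∣ n → q ≡ p)

HasAtLeastTwoPrimeFactors : ℕ → Set
HasAtLeastTwoPrimeFactors n =
  ∃[ p ] ∃[ q ] Prime p × Prime q × p ≢ q × p ∣ n × q ∣ n

IsPowerOfTwo : ℕ → Set
IsPowerOfTwo n = ∃[ m ] n ≡ 2 ^ m

-- If p is the only prime factor of n, every divisor of n other than 1 is a multiple
-- of p, so a sum of distinct divisors of n is 1 mod p if it contains 1 and 0 mod p
-- otherwise. Reading σ(n) + (d₁ + ⋯ + dₖ) = 2n mod p, where σ(n) ≡ 1, gives p ∣ 1
-- (impossible) if no dᵢ is 1 and p ∣ 2 otherwise; so p = 2 and n = 2ᵃ. Then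
-- σ(n) ≥ 1 + 2 + ⋯ + 2ᵃ = 2n − 1 forces d₁ + ⋯ + dₖ ≤ 1, i.e. k = 1.

module Submission where

open import Defs
open import Data.Nat using (ℕ; zero; suc; _+_; _*_; _^_; _<_; _≤_; z≤n; s≤s; NonZero; ≢-nonZero⁻¹)
open import Data.Nat.Properties
open import Data.Nat.Divisibility
open import Data.Nat.Primality using (Prime; prime⇒nonTrivial; ¬prime[1])
open import Data.Nat.Primality.Factorisation
open PrimeFactorisation using (isFactorisation; factorsPrime)
open import Data.Nat.Base using (nonTrivial⇒n>1)
open import Data.Nat.ListAction using (sum; product)
open import Data.Nat.ListAction.Properties using (sum-↭; ∈⇒∣product)
open import Data.List using ([]; _∷_; _++_; [_]; map; upTo; applyDownFrom; length)
open import Data.List.Relation.Unary.All as All using (All; []; _∷_)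
open import Data.List.Relation.Unary.All.Properties.Core using (¬All⇒Any¬; All¬⇒¬Any)
open import Data.List.Relation.Unary.Any using (here; there)
open import Data.List.Relation.Unary.AllPairs using (_∷_)
open import Data.List.Relation.Unary.Unique.Propositional using (Unique)
import Data.List.Relation.Unary.Unique.Propositional.Properties as Unique
open import Data.List.Relation.Binary.Subset.Propositional using (_⊆_)
open import Data.List.Relation.Binary.Permutation.Propositional.Properties using (shift; ∈-resp-↭)
open import Data.List.Membership.Propositional using (_∈_; _∉_; find)
open import Data.List.Membership.Propositional.Properties
open import Data.List.Membership.DecPropositional _≟_ using (_∈?_)
open import Data.Product using (∃-syntax; _×_; _,_; proj₁; proj₂)
open import Data.Sum using (_⊎_; inj₁; inj₂)
open import Relation.Nullary using (Dec; yes; no; contradiction)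
open import Function using (_∘_)
open import Relation.Binary.PropositionalEquality
  using (_≡_; refl; sym; trans; cong; cong₂; subst; module ≡-Reasoning)

length≤sum : ∀ {xs} → All (0 <_) xs → length xs ≤ sum xs
length≤sum []         = z≤n
length≤sum (x>0 ∷ xs) = +-mono-≤ x>0 (length≤sum xs)

sum-mono-⊆ : ∀ {xs ys} → Unique xs → xs ⊆ ys → sum xs ≤ sum ys
sum-mono-⊆ {[]}     _             _     = z≤n
sum-mono-⊆ {x ∷ xs} (x∉xs ∷ xs!) xs⊆ys with as , bs , refl ← ∈-∃++ (xs⊆ys (here refl)) =
  begin
    x + sum xs             ≤⟨ +-monoʳ-≤ x (sum-mono-⊆ xs! xs⊆as++bs) ⟩
    x + sum (as ++ bs)     ≡⟨ sum-↭ (shift x as bs) ⟨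
    sum (as ++ [ x ] ++ bs) ∎
  where
  open ≤-Reasoning
  xs⊆as++bs : xs ⊆ as ++ bs
  xs⊆as++bs {z} z∈xs with ∈-resp-↭ (shift x as bs) (xs⊆ys (there z∈xs))
  ... | here refl = contradiction refl (All.lookup x∉xs z∈xs)
  ... | there z∈ = z∈

∈-divisors⁻ : ∀ {n x} → x ∈ divisors n → x ∣ n
∈-divisors⁻ {n} x∈ = proj₂ (∈-filter⁻ (_∣? n) {xs = map suc (upTo n)} x∈)

∈-divisors⁺ : ∀ {n x} .{{_ : NonZero n}} → x ∣ n → x ∈ divisors n
∈-divisors⁺ {n} {zero}  0∣n  = contradiction (0∣⇒≡0 0∣n) (≢-nonZero⁻¹ n)
∈-divisors⁺ {n} {suc x} x∣n = ∈-filter⁺ (_∣? n) (∈-map⁺ suc (∈-upTo⁺ (∣⇒≤ x∣n))) x∣n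

divisors-unique : ∀ n → Unique (divisors n)
divisors-unique n = Unique.filter⁺ (_∣? n) (Unique.map⁺ suc-injective (Unique.upTo⁺ n))

module _ {p : ℕ} where

  sum-∌1 : ∀ {xs} → All (λ x → x ≡ 1 ⊎ p ∣ x) xs → 1 ∉ xs → p ∣ sum xs
  sum-∌1 []               _  = p ∣0
  sum-∌1 (inj₁ refl ∷ _)  1∉ = contradiction (here refl) 1∉
  sum-∌1 (inj₂ p∣x ∷ xs)  1∉ = ∣m∣n⇒∣m+n p∣x (sum-∌1 xs (1∉ ∘ there))

  sum-∋1 : ∀ {xs} → Unique xs → All (λ x → x ≡ 1 ⊎ p ∣ x) xs → 1 ∈ xs →
           ∃[ t ] sum xs ≡ suc t × p ∣ t
  sum-∋1 {_ ∷ xs} (1∉xs ∷ _) (_ ∷ ps) (here refl) =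
    sum xs , refl , sum-∌1 ps (All¬⇒¬Any 1∉xs)
  sum-∋1 (x∉xs ∷ _) (inj₁ refl ∷ _) (there 1∈xs) = contradiction refl (All.lookup x∉xs 1∈xs)
  sum-∋1 {x ∷ _} (_ ∷ xs!) (inj₂ p∣x ∷ ps) (there 1∈xs) =
    let t , sum≡ , p∣t = sum-∋1 xs! ps 1∈xs
    in x + t , trans (cong (x +_) sum≡) (+-suc x t) , ∣m∣n⇒∣m+n p∣x p∣t

prime⇒≥2 : ∀ {p} → Prime p → 2 ≤ p
prime⇒≥2 {p} p-prime = nonTrivial⇒n>1 p {{prime⇒nonTrivial p-prime}}

All≡⇒product≡^length : ∀ {p xs} → All (_≡ p) xs → product xs ≡ p ^ length xs
All≡⇒product≡^length []                = refl
All≡⇒product≡^length {p} (refl ∷ xs≡p) = cong (p *_) (All≡⇒product≡^length xs≡p)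

∈-factors⁻ : ∀ {n q} .{{_ : NonZero n}} → q ∈ factors (factorise n) → Prime q × q ∣ n
∈-factors⁻ {n} {q} q∈ =
  All.lookup (factorsPrime F) q∈ , subst (q ∣_) (sym (isFactorisation F)) (∈⇒∣product q∈)
  where F = factorise n

prime∣⇒∈factors : ∀ {n q} .{{_ : NonZero n}} → Prime q → q ∣ n → q ∈ factors (factorise n)
prime∣⇒∈factors {n} {q} q-prime q∣n =
  factorisationHasAllPrimeFactors q-prime (subst (q ∣_) (isFactorisation F) q∣n) (factorsPrime F)
  where F = factorise n

∃prime∣ : ∀ {n} → 2 ≤ n → ∃[ q ] Prime q × q ∣ n
∃prime∣ {n@(suc _)} 2≤n with factorise n
... | record { factors = [] ; isFactorisation = n≡1 } =
  contradiction (subst (2 ≤_) n≡1 2≤n) λ { (s≤s ()) }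
... | record { factors = q ∷ qs ; isFactorisation = n≡ ; factorsPrime = q-prime ∷ _ } =
  q , q-prime , subst (q ∣_) (sym n≡) (m∣m*n (product qs))

OnlyPrimeFactor : ℕ → ℕ → Set
OnlyPrimeFactor p n = ∀ q → Prime q → q ∣ n → q ≡ p

module _ {p n : ℕ} (only-p : OnlyPrimeFactor p n) where

  onlyPrimeFactor⇒∣⇒≡1⊎p∣ : ∀ {x} → x ∣ n → x ≡ 1 ⊎ p ∣ x
  onlyPrimeFactor⇒∣⇒≡1⊎p∣ {zero}        _   = inj₂ (p ∣0)
  onlyPrimeFactor⇒∣⇒≡1⊎p∣ {suc zero}    _   = inj₁ refl
  onlyPrimeFactor⇒∣⇒≡1⊎p∣ {suc (suc x)} x∣n =
    let q , q-prime , q∣x = ∃prime∣ (s≤s (s≤s z≤n))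
    in inj₂ (subst (_∣ suc (suc x)) (only-p q q-prime (∣-trans q∣x x∣n)) q∣x)

  onlyPrimeFactor⇒≡^ : .{{_ : NonZero n}} → ∃[ a ] n ≡ p ^ a
  onlyPrimeFactor⇒≡^ =
    length (factors F) , trans (isFactorisation F) (All≡⇒product≡^length factors≡p)
    where
    F = factorise n
    factors≡p : All (_≡ p) (factors F)
    factors≡p = All.tabulate λ q∈ → let q-prime , q∣n = ∈-factors⁻ q∈ in only-p _ q-prime q∣n

  σ≡1+multiple : .{{_ : NonZero n}} → ∃[ s ] σ n ≡ suc s × p ∣ s
  σ≡1+multiple = sum-∋1 (divisors-unique n)
    (All.tabulate (onlyPrimeFactor⇒∣⇒≡1⊎p∣ ∘ ∈-divisors⁻)) (∈-divisors⁺ (1∣ n))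

onePrimeFactor⊎atLeastTwo : ∀ {n} → 2 ≤ n →
  HasExactlyOnePrimeFactor n ⊎ HasAtLeastTwoPrimeFactors n
onePrimeFactor⊎atLeastTwo {n@(suc _)} 2≤n with p , p-prime , p∣n ← ∃prime∣ 2≤n
  with All.all? (_≟ p) (factors (factorise n))
... | yes factors≡p =
  inj₁ (p , p-prime , p∣n , λ q q-prime q∣n → All.lookup factors≡p (prime∣⇒∈factors q-prime q∣n))
... | no ¬factors≡p with q , q∈ , q≢p ← find (¬All⇒Any¬ (_≟ p) _ ¬factors≡p) =
  let q-prime , q∣n = ∈-factors⁻ q∈
  in inj₂ (p , q , p-prime , q-prime , q≢p ∘ sym , p∣n , q∣n)

sum-powersOf2 : ∀ m → sum (applyDownFrom (2 ^_) m) + 1 ≡ 2 ^ m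
sum-powersOf2 zero    = refl
sum-powersOf2 (suc m) = begin
  2 ^ m + sum (applyDownFrom (2 ^_) m) + 1   ≡⟨ +-assoc (2 ^ m) _ 1 ⟩
  2 ^ m + (sum (applyDownFrom (2 ^_) m) + 1) ≡⟨ cong (2 ^ m +_) (sum-powersOf2 m) ⟩
  2 ^ m + 2 ^ m                              ≡⟨ cong (2 ^ m +_) (+-identityʳ (2 ^ m)) ⟨
  2 ^ suc m                                  ∎
  where open ≡-Reasoning

powersOf2-∣ : ∀ a → All (_∣ 2 ^ a) (applyDownFrom (2 ^_) (suc a))
powersOf2-∣ zero    = ∣-refl ∷ []
powersOf2-∣ (suc a) = ∣-refl ∷ All.map (λ x∣2^a → ∣-trans x∣2^a (n∣m*n 2)) (powersOf2-∣ a)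

powersOf2-unique : ∀ m → Unique (applyDownFrom (2 ^_) m)
powersOf2-unique m =
  Unique.applyDownFrom⁺₁ (2 ^_) m (λ j<i _ → >⇒≢ (^-monoʳ-< 2 (s≤s (s≤s z≤n)) j<i))

2^[1+a]≤σ[2^a]+1 : ∀ a → 2 ^ suc a ≤ σ (2 ^ a) + 1
2^[1+a]≤σ[2^a]+1 a = subst (_≤ σ (2 ^ a) + 1) (sum-powersOf2 (suc a))
  (+-monoˡ-≤ 1 (sum-mono-⊆ (powersOf2-unique (suc a))
    (∈-divisors⁺ {{m^n≢0 2 a}} ∘ All.lookup (powersOf2-∣ a))))

deficientPerfect⇒onlyPrimeFactor≡2 : ∀ {k n p} .{{_ : NonZero n}} → Prime p → p ∣ n →
  OnlyPrimeFactor p n → ExactlyDeficientPerfect k n → p ≡ 2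
deficientPerfect⇒onlyPrimeFactor≡2 {n = n} {p} p-prime p∣n only-p
  (ds , _ , ds! , ds-proper , σ+sum≡2n)
  with s , σ≡1+s , p∣s ← σ≡1+multiple only-p = p≡2 (1 ∈? ds)
  where
  p∣σ+sum : p ∣ σ n + sum ds
  p∣σ+sum = subst (p ∣_) (sym σ+sum≡2n) (∣n⇒∣m*n 2 p∣n)
  ds-cases : All (λ d → d ≡ 1 ⊎ p ∣ d) ds
  ds-cases = All.map (λ (_ , d∣n , _) → onlyPrimeFactor⇒∣⇒≡1⊎p∣ only-p d∣n) ds-proper
  p≡2 : Dec (1 ∈ ds) → p ≡ 2
  p≡2 (no 1∉ds) = contradiction (subst Prime (∣1⇒≡1 p∣1) p-prime) ¬prime[1]
    where
    σ+sum≡ : σ n + sum ds ≡ (s + sum ds) + 1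
    σ+sum≡ = trans (cong (_+ sum ds) σ≡1+s) (+-comm 1 (s + sum ds))
    p∣1 : p ∣ 1
    p∣1 = ∣m+n∣m⇒∣n (subst (p ∣_) σ+sum≡ p∣σ+sum) (∣m∣n⇒∣m+n p∣s (sum-∌1 ds-cases 1∉ds))
  p≡2 (yes 1∈ds) with t , sum≡1+t , p∣t ← sum-∋1 ds! ds-cases 1∈ds =
    ≤-antisym (∣⇒≤ p∣2) (prime⇒≥2 p-prime)
    where
    σ+sum≡ : σ n + sum ds ≡ (s + t) + 2
    σ+sum≡ = begin
      σ n + sum ds    ≡⟨ cong₂ _+_ σ≡1+s sum≡1+t ⟩
      suc s + suc t   ≡⟨ cong suc (+-suc s t) ⟩
      2 + (s + t)     ≡⟨ +-comm 2 (s + t) ⟩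
      (s + t) + 2     ∎
      where open ≡-Reasoning
    p∣2 : p ∣ 2
    p∣2 = ∣m+n∣m⇒∣n (subst (p ∣_) σ+sum≡ p∣σ+sum) (∣m∣n⇒∣m+n p∣s p∣t)

deficientPerfect-2^a⇒k≤1 : ∀ {k} a → ExactlyDeficientPerfect k (2 ^ a) → k ≤ 1
deficientPerfect-2^a⇒k≤1 a (ds , refl , _ , ds-proper , σ+sum≡) = begin
  length ds ≤⟨ length≤sum (All.map proj₁ ds-proper) ⟩
  sum ds    ≤⟨ +-cancelˡ-≤ (σ (2 ^ a)) (sum ds) 1 σ+sum≤σ+1 ⟩
  1         ∎
  where
  open ≤-Reasoning
  σ+sum≤σ+1 : σ (2 ^ a) + sum ds ≤ σ (2 ^ a) + 1
  σ+sum≤σ+1 = subst (_≤ σ (2 ^ a) + 1) (sym σ+sum≡) (2^[1+a]≤σ[2^a]+1 a)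

onePrimeFactor⇒k≡1×powerOfTwo : ∀ n k → 2 ≤ n → 1 ≤ k → ExactlyDeficientPerfect k n →
  HasExactlyOnePrimeFactor n → (k ≡ 1) × IsPowerOfTwo n
onePrimeFactor⇒k≡1×powerOfTwo n@(suc _) k _ 1≤k n-edp (p , p-prime , p∣n , only-p)
  with refl ← deficientPerfect⇒onlyPrimeFactor≡2 p-prime p∣n only-p n-edp
  with a , n≡2^a ← onlyPrimeFactor⇒≡^ only-p =
  ≤-antisym (deficientPerfect-2^a⇒k≤1 a (subst (ExactlyDeficientPerfect k) n≡2^a n-edp)) 1≤k ,
  a , n≡2^a

k≥2⇒atLeastTwoPrimeFactors : ∀ n k → 2 ≤ n → 2 ≤ k → ExactlyDeficientPerfect k n →
  HasAtLeastTwoPrimeFactors n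
k≥2⇒atLeastTwoPrimeFactors n k 2≤n 2≤k n-edp with onePrimeFactor⊎atLeastTwo 2≤n
... | inj₂ two = two
... | inj₁ one with refl ← proj₁ (onePrimeFactor⇒k≡1×powerOfTwo n k 2≤n (<⇒≤ 2≤k) n-edp one) =
  contradiction 2≤k λ { (s≤s ()) }

lemma2 : (∀ (n k : ℕ) → 2 ≤ n → 1 ≤ k → ExactlyDeficientPerfect k n
    → HasExactlyOnePrimeFactor n → (k ≡ 1) × IsPowerOfTwo n)
    × (∀ (n k : ℕ) → 2 ≤ n → 2 ≤ k → ExactlyDeficientPerfect k n
    → HasAtLeastTwoPrimeFactors n)
    × (∀ (n : ℕ) → 2 ≤ n → ExactlyDeficientPerfect 3 n
    → HasAtLeastTwoPrimeFactors n)
lemma2 = onePrimeFactor⇒k≡1×powerOfTwo , k≥2⇒atLeastTwoPrimeFactors ,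
         λ n 2≤n → k≥2⇒atLeastTwoPrimeFactors n 3 2≤n (s≤s (s≤s z≤n))
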